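{- Let $H=(V,E,C,\ell)$ be an edge-colored hypergraph with $k=|C|$ colors and nonnegative edge weights $w$, and let $\{x_e\}_{e\in E}$ be an optimal solution of $\text{LP}_\text{VC}$ that is half-integral ($x_e\in\{0,1/2,1\}$ for all $e$). Let $E^1=\{e:x_e=1\}$, $E^{1/2}=\{e:x_e=1/2\}$, let $i^*\in\arg\max_{i\in C} w(E_i\cap E^{1/2})$, and let $Y=E^1\cup(E^{1/2}\setminus (E_{i^*}\cap E^{1/2}))$. Then $E\setminus Y$ contains no bad edge pair (so nodes can be colored so that every edge in $E\setminus Y$ is satisfied), and $w(Y)\le (2-\tfrac{2}{k})\,\mathrm{OPT}$, where $\mathrm{OPT}$ is the optimal value of \textsc{MinECC} on $H$. That is, this rounding procedure is a $(2-\tfrac2k)$-approximation for \textsc{MinECC}.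
   Context: An edge-colored hypergraph $H=(V,E,C,\ell)$ has node set $V$, hyperedge set $E$, color set $C=\{1,\dots,k\}$, and color map $\ell:E\to C$; $E_i=\{e\in E:\ell(e)=i\}$; weights $w(e)\ge0$ and $w(A)=\sum_{e\in A}w(e)$. In \textsc{MinECC} one assigns each node a color; a hyperedge $e$ is satisfied if all its nodes receive color $\ell(e)$; the goal is to minimize the total weight of unsatisfied edges. A pair $(e,f)$ of hyperedges is a bad edge pair if $e\cap f\neq\emptyset$ and $\ell(e)\ne\ell(f)$; $\mathcal{B}$ is the set of bad edge pairs. $\text{LP}_\text{VC}$ is the linear program: minimize $\sum_{e\in E}w(e)x_e$ subject to $x_e+x_f\ge1$ for all $(e,f)\in\mathcal{B}$ and $x_e\ge0$ for all $e\in E$.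
   Formalization: The edge weights $w$ are rational, and optimality in $\text{LP}_\text{VC}$ is taken over rational feasible points. -}

module Defs where

open import Data.Nat using (ℕ; zero; suc)
open import Data.Fin using (Fin; zero; suc)
open import Data.Fin.Subset using (Subset; _∈_)
open import Data.Fin.Subset.Properties using (_∈?_)
open import Data.Fin.Properties using (all?) renaming (_≟_ to _≟ᶠ_)
open import Data.Rational using (ℚ; 0ℚ; 1ℚ; ½; _+_; _*_; _≤_)
open import Data.Rational.Properties using (_≟_)
open import Data.Bool using (Bool; true; false; if_then_else_; _∨_; _∧_; not)
open import Data.Product using (_×_; ∃-syntax)
open import Relation.Nullary using (¬_; does)
open import Relation.Nullary.Decidable using (_→-dec_)
open import Relation.Binary.PropositionalEquality using (_≡_; _≢_)

-- Edge-colored hypergraph H = (V, E, C, ℓ) with V = Fin n, E = Fin m, C = Fin k.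
-- Each hyperedge is a subset of the nodes; ℓ gives its color.
record ECHypergraph (n m k : ℕ) : Set where
  field
    edge  : Fin m → Subset n
    color : Fin m → Fin k
open ECHypergraph public

Σ : ∀ {m} → (Fin m → ℚ) → ℚ
Σ {zero}  f = 0ℚ
Σ {suc m} f = f zero + Σ (λ i → f (suc i))

wt : ∀ {m} → (Fin m → ℚ) → (Fin m → Bool) → ℚ
wt w A = Σ (λ e → if A e then w e else 0ℚ)

module _ {n m k : ℕ} (H : ECHypergraph n m k) where

  BadPair : Fin m → Fin m → Set
  BadPair e f = (∃[ v ] (v ∈ edge H e × v ∈ edge H f)) × color H e ≢ color H f

  FeasibleVC : (Fin m → ℚ) → Set
  FeasibleVC x = (∀ e → 0ℚ ≤ x e) × (∀ e f → BadPair e f → 1ℚ ≤ x e + x f)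

  objVC : (Fin m → ℚ) → (Fin m → ℚ) → ℚ
  objVC w x = Σ (λ e → w e * x e)

  OptimalVC : (Fin m → ℚ) → (Fin m → ℚ) → Set
  OptimalVC w x = FeasibleVC x × (∀ y → FeasibleVC y → objVC w x ≤ objVC w y)

  HalfIntegral : (Fin m → ℚ) → Set
  HalfIntegral x = ∀ e → x e ≡ 0ℚ ⊎' (x e ≡ ½ ⊎' x e ≡ 1ℚ)
    where open import Data.Sum renaming (_⊎_ to _⊎'_)

  Satisfied : (Fin n → Fin k) → Fin m → Set
  Satisfied c e = ∀ v → v ∈ edge H e → c v ≡ color H e

  satisfiedᵇ : (Fin n → Fin k) → Fin m → Bool
  satisfiedᵇ c e = does (all? (λ v → (v ∈? edge H e) →-dec (c v ≟ᶠ color H e)))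

  eccCost : (Fin m → ℚ) → (Fin n → Fin k) → ℚ
  eccCost w c = wt w (λ e → not (satisfiedᵇ c e))

  halfOfColor : (Fin m → ℚ) → Fin k → Fin m → Bool
  halfOfColor x i e = does (x e ≟ ½) ∧ does (color H e ≟ᶠ i)

  roundY : (Fin m → ℚ) → Fin k → Fin m → Bool
  roundY x i* e = does (x e ≟ 1ℚ) ∨ (does (x e ≟ ½) ∧ not (does (color H e ≟ᶠ i*)))

-- An edge outside Y has x_e = 0, or x_e = ½ and color i*. Since x covers every bad pair
-- (x_e + x_f ≥ 1), two such edges form a bad pair only if both are half-valued, but then
-- they have the same color; so coloring each node like some edge outside Y containing it
-- satisfies all of them.
-- For the cost write A = w(E¹), B = w(E½) and M = w(E_{i*} ∩ E½). Then w(Y) = A + B − M,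
-- the LP value is A + B/2 ≤ OPT (the unsatisfied edges of any coloring cover all bad
-- pairs), and M ≥ B/k because i* is the heaviest of the k color classes of E½. Hence
-- w(Y) ≤ A + (1 − 1/k) B ≤ (2 − 2/k)(A + B/2) for k ≥ 2; for k = 1 there are no bad
-- pairs, so the LP value, and with it A, is 0.

{-# OPTIONS --safe #-}
module Submission where

open import Defs
open import Data.Nat using (ℕ; NonZero)
open import Data.Fin using (Fin)
open import Data.Integer using (+_)
open import Data.Rational using (ℚ; 0ℚ; _≤_; _*_; _-_; _/_)
open import Data.Bool using (false)
open import Data.Product using (_×_; ∃-syntax)
open import Relation.Nullary using (¬_)
open import Relation.Binary.PropositionalEquality using (_≡_)

open import Algebra.Bundles using (CommutativeRing)
open import Data.Bool using (Bool; true; if_then_else_; _∨_; _∧_; not)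
open import Data.Bool.Properties using () renaming (_≟_ to _≟ᵇ_)
open import Data.Empty using (⊥)
open import Data.Fin using (zero; suc)
open import Data.Fin.Properties using (any?; all?) renaming (_≟_ to _≟ᶠ_)
open import Data.Fin.Subset using (_∈_)
open import Data.Fin.Subset.Properties using (_∈?_)
import Data.Integer as ℤ
import Data.Integer.Properties as ℤ
open import Data.Nat using (zero; suc; s≤s; z≤n)
import Data.Nat.Properties as ℕ
open import Data.Product using (_,_)
open import Data.Rational using (1ℚ; ½; _+_; toℚᵘ; nonNegative)
open import Data.Rational.Properties
open import Data.Rational.Solver using (module +-*-Solver)
import Data.Rational.Unnormalised as ℚᵘ
import Data.Rational.Unnormalised.Properties as ℚᵘ
open import Data.Sum using (_⊎_; inj₁; inj₂)
open import Relation.Nullary using (Dec; yes; no; does; contradiction)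
open import Relation.Nullary.Decidable using (decidable-stable; from-yes; from-no; _→-dec_; _×-dec_)
open import Relation.Unary using (Decidable)
open import Relation.Binary.PropositionalEquality
  using (refl; sym; trans; cong; cong₂; subst; module ≡-Reasoning)
open import Algebra.Properties.Semiring.Sum (CommutativeRing.semiring +-*-commutativeRing)
  using (sum; sum-syntax; ∑-distrib-+; ∑-comm; *-distribˡ-sum; sum-cong-≗; sum-replicate-zero)

open +-*-Solver using (solve; _:+_; _:*_; _:-_; _:=_; con)

approxRatio : (k : ℕ) .{{_ : NonZero k}} → ℚ
approxRatio k = (+ 2 / 1) - (+ 2 / k)

-- Identities between rationals with a variable numerator or denominator are checked on
-- unnormalised representatives, where no gcd has to be computed.
2/k*k≡2 : ∀ k .{{_ : NonZero k}} → (+ 2 / k) * (+ k / 1) ≡ + 2 / 1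
2/k*k≡2 (suc k) = toℚᵘ-injective (begin-equality
  toℚᵘ ((+ 2 / suc k) * (+ suc k / 1))        ≃⟨ toℚᵘ-homo-* (+ 2 / suc k) (+ suc k / 1) ⟩
  toℚᵘ (+ 2 / suc k) ℚᵘ.* toℚᵘ (+ suc k / 1)  ≃⟨ ℚᵘ.*-cong (toℚᵘ-fromℚᵘ (ℚᵘ.mkℚᵘ (+ 2) k))
                                                             (toℚᵘ-fromℚᵘ (ℚᵘ.mkℚᵘ (+ suc k) 0)) ⟩
  ℚᵘ.mkℚᵘ (+ 2) k ℚᵘ.* ℚᵘ.mkℚᵘ (+ suc k) 0    ≃⟨ ℚᵘ.*≡* (cong (+_) (ℕ.*-assoc 2 (suc k) 1)) ⟩
  ℚᵘ.mkℚᵘ (+ 2) 0                             ≃⟨ toℚᵘ-fromℚᵘ (ℚᵘ.mkℚᵘ (+ 2) 0) ⟨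
  toℚᵘ (+ 2 / 1)                              ∎)
  where open ℚᵘ.≤-Reasoning

[1+n]/1≡1+n/1 : ∀ n → + suc n / 1 ≡ 1ℚ + + n / 1
[1+n]/1≡1+n/1 n = toℚᵘ-injective (begin-equality
  toℚᵘ (+ suc n / 1)                ≃⟨ toℚᵘ-fromℚᵘ (ℚᵘ.mkℚᵘ (+ suc n) 0) ⟩
  ℚᵘ.mkℚᵘ (+ suc n) 0               ≃⟨ ℚᵘ.≃-reflexive (cong (λ i → ℚᵘ.mkℚᵘ (ℤ._+_ (+ 1) i) 0)
                                                              (sym (ℤ.*-identityʳ (+ n)))) ⟩
  ℚᵘ.1ℚᵘ ℚᵘ.+ ℚᵘ.mkℚᵘ (+ n) 0       ≃⟨ ℚᵘ.+-congʳ ℚᵘ.1ℚᵘ (toℚᵘ-fromℚᵘ (ℚᵘ.mkℚᵘ (+ n) 0)) ⟨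
  toℚᵘ 1ℚ ℚᵘ.+ toℚᵘ (+ n / 1)       ≃⟨ toℚᵘ-homo-+ 1ℚ (+ n / 1) ⟨
  toℚᵘ (1ℚ + + n / 1)               ∎)
  where open ℚᵘ.≤-Reasoning

2/[2+k]≤1 : ∀ k → + 2 / suc (suc k) ≤ 1ℚ
2/[2+k]≤1 k = toℚᵘ-cancel-≤ (begin
  toℚᵘ (+ 2 / suc (suc k))  ≃⟨ toℚᵘ-fromℚᵘ (ℚᵘ.mkℚᵘ (+ 2) (suc k)) ⟩
  ℚᵘ.mkℚᵘ (+ 2) (suc k)     ≤⟨ ℚᵘ.*≤* (ℤ.+≤+ (s≤s (s≤s z≤n))) ⟩
  toℚᵘ 1ℚ                   ∎)
  where open ℚᵘ.≤-Reasoning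

1≤approxRatio : ∀ k → 1ℚ ≤ approxRatio (suc (suc k))
1≤approxRatio k = +-monoʳ-≤ (+ 2 / 1) (neg-antimono-≤ (2/[2+k]≤1 k))

approxRatio-nonNeg : ∀ k .{{_ : NonZero k}} → 0ℚ ≤ approxRatio k
approxRatio-nonNeg (suc zero)    = ≤-refl
approxRatio-nonNeg (suc (suc k)) = ≤-trans (from-yes (0ℚ ≤? 1ℚ)) (1≤approxRatio k)

≤-approxRatio-* : ∀ k .{{_ : NonZero k}} {a} → 0ℚ ≤ a → (k ≡ 1 → a ≤ 0ℚ) → a ≤ approxRatio k * a
≤-approxRatio-* (suc zero)    {a} _   a≤0 = subst (a ≤_) (sym (*-zeroˡ a)) (a≤0 refl)
≤-approxRatio-* (suc (suc k)) {a} 0≤a _   = subst (_≤ approxRatio (suc (suc k)) * a) (*-identityˡ a)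
  (*-monoʳ-≤-nonNeg a {{nonNegative 0≤a}} (1≤approxRatio k))

rounding-bound : ∀ k .{{_ : NonZero k}} {W M A B LP E : ℚ} →
                 W + M ≡ A + B → LP ≡ A + ½ * B → B ≤ (+ k / 1) * M →
                 A ≤ approxRatio k * A → LP ≤ E → W ≤ approxRatio k * E
rounding-bound k {W} {M} {A} {B} {LP} {E} W+M≡A+B LP≡A+½B B≤kM A≤ratio*A LP≤E = begin
  W                                ≡⟨ solve 2 (λ W M → W := (W :+ M) :- M) refl W M ⟩
  (W + M) - M                      ≡⟨ cong (_- M) W+M≡A+B ⟩
  (A + B) - M                      ≤⟨ +-monoʳ-≤ (A + B) (neg-antimono-≤ B/k≤M) ⟩
  (A + B) - 1/k * B                ≡⟨ solve 3 (λ s A B → (A :+ B) :- s :* B := A :+ (con 1ℚ :- s) :* B)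
                                            refl 1/k A B ⟩
  A + (1ℚ - 1/k) * B               ≤⟨ +-monoˡ-≤ ((1ℚ - 1/k) * B) A≤ratio*A ⟩
  approxRatio k * A + (1ℚ - 1/k) * B
                                   ≡⟨ solve 3 (λ t A B → (con (+ 2 / 1) :- t) :* A :+ (con 1ℚ :- con ½ :* t) :* B
                                                     := (con (+ 2 / 1) :- t) :* (A :+ con ½ :* B))
                                            refl 2/k A B ⟩
  approxRatio k * (A + ½ * B)      ≡⟨ cong (approxRatio k *_) LP≡A+½B ⟨
  approxRatio k * LP               ≤⟨ *-monoˡ-≤-nonNeg (approxRatio k)
                                            {{nonNegative (approxRatio-nonNeg k)}} LP≤E ⟩
  approxRatio k * E                ∎
  where
  open ≤-Reasoning
  2/k 1/k : ℚ
  2/k = + 2 / k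
  1/k = ½ * 2/k
  B/k≤M : 1/k * B ≤ M
  B/k≤M = begin
    1/k * B                   ≤⟨ *-monoˡ-≤-nonNeg 1/k {{nonNeg*nonNeg⇒nonNeg ½ 2/k {{normalize-nonNeg 2 k}}}}
                                                   B≤kM ⟩
    1/k * ((+ k / 1) * M)     ≡⟨ solve 3 (λ t K M → con ½ :* t :* (K :* M) := con ½ :* (t :* K) :* M)
                                       refl 2/k (+ k / 1) M ⟩
    ½ * (2/k * (+ k / 1)) * M ≡⟨ cong (λ c → ½ * c * M) (2/k*k≡2 k) ⟩
    1ℚ * M                    ≡⟨ *-identityˡ M ⟩
    M                         ∎

infix 11 [_]_

[_]_ : Bool → ℚ → ℚ
[ b ] q = if b then q else 0ℚ

[]-nonNeg : ∀ b {q} → 0ℚ ≤ q → 0ℚ ≤ [ b ] q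
[]-nonNeg true  0≤q = 0≤q
[]-nonNeg false _   = ≤-refl

*-[]1 : ∀ q b → q * [ b ] 1ℚ ≡ [ b ] q
*-[]1 q true  = *-identityʳ q
*-[]1 q false = *-zeroʳ q

1≤[no]+[no] : ∀ {P Q : Set} (P? : Dec P) (Q? : Dec Q) → ¬ (P × Q) →
              1ℚ ≤ [ not (does P?) ] 1ℚ + [ not (does Q?) ] 1ℚ
1≤[no]+[no] (yes p) (yes q) ¬p×q = contradiction (p , q) ¬p×q
1≤[no]+[no] (yes _) (no _)  _    = ≤-refl
1≤[no]+[no] (no _)  (yes _) _    = ≤-refl
1≤[no]+[no] (no _)  (no _)  _    = from-yes (1ℚ ≤? 1ℚ + 1ℚ)

infixl 9 _↾_

_↾_ : ∀ {m} → (Fin m → ℚ) → (Fin m → Bool) → Fin m → ℚ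
(w ↾ A) e = [ A e ] w e

Σ≡sum : ∀ {m} (f : Fin m → ℚ) → Σ f ≡ sum f
Σ≡sum {zero}  f = refl
Σ≡sum {suc m} f = cong (_+_ (f zero)) (Σ≡sum (λ i → f (suc i)))

wt≡sum : ∀ {m} (w : Fin m → ℚ) A → wt w A ≡ sum (w ↾ A)
wt≡sum w A = Σ≡sum (w ↾ A)

objVC≡sum : ∀ {n m k} (H : ECHypergraph n m k) w x → objVC H w x ≡ ∑[ e < m ] (w e * x e)
objVC≡sum H w x = Σ≡sum (λ e → w e * x e)

sum-mono-≤ : ∀ {m} {f g : Fin m → ℚ} → (∀ i → f i ≤ g i) → sum f ≤ sum g
sum-mono-≤ {zero}  _   = ≤-refl
sum-mono-≤ {suc m} f≤g = +-mono-≤ (f≤g zero) (sum-mono-≤ (λ i → f≤g (suc i)))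

sum-const : ∀ n q → ∑[ i < n ] q ≡ (+ n / 1) * q
sum-const zero    q = sym (*-zeroˡ q)
sum-const (suc n) q = begin
  q + ∑[ i < n ] q         ≡⟨ cong (_+_ q) (sum-const n q) ⟩
  q + (+ n / 1) * q        ≡⟨ solve 2 (λ q N → q :+ N :* q := (con 1ℚ :+ N) :* q) refl q (+ n / 1) ⟩
  (1ℚ + + n / 1) * q       ≡⟨ cong (_* q) ([1+n]/1≡1+n/1 n) ⟨
  (+ suc n / 1) * q        ∎
  where open ≡-Reasoning

sum-indicator : ∀ {k} (c : Fin k) q → ∑[ i < k ] [ does (c ≟ᶠ i) ] q ≡ q
sum-indicator {suc k} zero    q = trans (cong (_+_ q) (sum-replicate-zero k)) (+-identityʳ q)
sum-indicator {suc k} (suc c) q = trans (+-identityˡ _) (sum-indicator c q)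

wt-nonNeg : ∀ {m} (w : Fin m → ℚ) A → (∀ e → 0ℚ ≤ w e) → 0ℚ ≤ wt w A
wt-nonNeg {m} w A 0≤w = begin
  0ℚ                          ≡⟨ sum-replicate-zero m ⟨
  ∑[ e < m ] 0ℚ               ≤⟨ sum-mono-≤ (λ e → []-nonNeg (A e) (0≤w e)) ⟩
  sum (w ↾ A)                 ≡⟨ wt≡sum w A ⟨
  wt w A                      ∎
  where open ≤-Reasoning

module _ {n m k : ℕ} (H : ECHypergraph n m k) where

  satisfied? : ∀ c e → Dec (Satisfied H c e)
  satisfied? c e = all? (λ v → (v ∈? edge H e) →-dec (c v ≟ᶠ color H e))

  badPair⇒¬bothSatisfied : ∀ c {e f} → BadPair H e f → ¬ (Satisfied H c e × Satisfied H c f)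
  badPair⇒¬bothSatisfied c ((v , v∈e , v∈f) , ℓe≢ℓf) (sat-e , sat-f) =
    ℓe≢ℓf (trans (sym (sat-e v v∈e)) (sat-f v v∈f))

  unsatisfied : (Fin n → Fin k) → Fin m → ℚ
  unsatisfied c e = [ not (does (satisfied? c e)) ] 1ℚ

  unsatisfied-feasible : ∀ c → FeasibleVC H (unsatisfied c)
  unsatisfied-feasible c =
      (λ e → []-nonNeg _ (from-yes (0ℚ ≤? 1ℚ)))
    , (λ e f bad → 1≤[no]+[no] (satisfied? c e) (satisfied? c f) (badPair⇒¬bothSatisfied c bad))

  objVC-unsatisfied : ∀ w c → objVC H w (unsatisfied c) ≡ eccCost H w c
  objVC-unsatisfied w c = begin
    objVC H w (unsatisfied c)                              ≡⟨ objVC≡sum H w (unsatisfied c) ⟩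
    ∑[ e < m ] (w e * unsatisfied c e)                     ≡⟨ sum-cong-≗ (λ e → *-[]1 (w e) _) ⟩
    sum (w ↾ (λ e → not (satisfiedᵇ H c e)))               ≡⟨ wt≡sum w (λ e → not (satisfiedᵇ H c e)) ⟨
    eccCost H w c                                          ∎
    where open ≡-Reasoning

  optimalVC≤eccCost : ∀ {w x} → OptimalVC H w x → ∀ c → objVC H w x ≤ eccCost H w c
  optimalVC≤eccCost {w} (_ , minimal) c =
    subst (_ ≤_) (objVC-unsatisfied w c) (minimal _ (unsatisfied-feasible c))

  optimalVC≤0 : ∀ {w x} → (∀ e f → ¬ BadPair H e f) → OptimalVC H w x → objVC H w x ≤ 0ℚ
  optimalVC≤0 {w} {x} noBadPair (_ , minimal) =
    subst (objVC H w x ≤_) objVC-0 (minimal (λ _ → 0ℚ) 0-feasible)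
    where
    0-feasible : FeasibleVC H (λ _ → 0ℚ)
    0-feasible = (λ _ → ≤-refl) , λ e f bad → contradiction bad (noBadPair e f)
    objVC-0 : objVC H w (λ _ → 0ℚ) ≡ 0ℚ
    objVC-0 = trans (objVC≡sum H w (λ _ → 0ℚ))
                    (trans (sum-cong-≗ (λ e → *-zeroʳ (w e))) (sum-replicate-zero m))

  compatible⇒satisfiable : Fin k → ∀ {K : Fin m → Set} → Decidable K →
                           (∀ e f → K e → K f → ¬ BadPair H e f) →
                           ∃[ c ] (∀ e → K e → Satisfied H c e)
  compatible⇒satisfiable default {K} K? compatible = c , c-satisfies
    where
    covering? : ∀ v → Dec (∃[ e ] (K e × v ∈ edge H e))
    covering? v = any? (λ e → K? e ×-dec (v ∈? edge H e))

    c : Fin n → Fin k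
    c v with covering? v
    ... | yes (e , _) = color H e
    ... | no _        = default

    c-satisfies : ∀ e → K e → Satisfied H c e
    c-satisfies e Ke v v∈e with covering? v
    ... | yes (f , Kf , v∈f) = decidable-stable (color H f ≟ᶠ color H e)
                                 (λ ℓf≢ℓe → compatible f e Kf Ke ((v , v∈f , v∈e) , ℓf≢ℓe))
    ... | no uncovered       = contradiction (e , Ke , v∈e) uncovered

monochromatic⇒¬BadPair : ∀ {n m} (H : ECHypergraph n m 1) e f → ¬ BadPair H e f
monochromatic⇒¬BadPair H e f (_ , ℓe≢ℓf) with color H e | color H f
... | zero | zero = ℓe≢ℓf refl

HalfIntegralValue : ℚ → Set
HalfIntegralValue v = v ≡ 0ℚ ⊎ (v ≡ ½ ⊎ v ≡ 1ℚ)

rounded-split : ∀ {v} → HalfIntegralValue v → ∀ c q →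
                [ does (v ≟ 1ℚ) ∨ (does (v ≟ ½) ∧ not c) ] q + [ does (v ≟ ½) ∧ c ] q
                  ≡ [ does (v ≟ 1ℚ) ] q + [ does (v ≟ ½) ] q
rounded-split (inj₁ refl)        c     q = refl
rounded-split (inj₂ (inj₁ refl)) true  q = refl
rounded-split (inj₂ (inj₁ refl)) false q = +-comm q 0ℚ
rounded-split (inj₂ (inj₂ refl)) c     q = refl

*-halfIntegral : ∀ {v} → HalfIntegralValue v → ∀ q →
                 q * v ≡ [ does (v ≟ 1ℚ) ] q + ½ * [ does (v ≟ ½) ] q
*-halfIntegral (inj₁ refl)        q = *-zeroʳ q
*-halfIntegral (inj₂ (inj₁ refl)) q = trans (*-comm q ½) (sym (+-identityˡ (½ * q)))
*-halfIntegral (inj₂ (inj₂ refl)) q = trans (*-identityʳ q) (sym (+-identityʳ q))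

module Rounding {n m k : ℕ} (H : ECHypergraph n m k)
                (x : Fin m → ℚ) (half-integral : HalfIntegral H x) (i* : Fin k) where

  Kept : Fin m → Set
  Kept e = roundY H x i* e ≡ false

  E¹ E½ : Fin m → Bool
  E¹ e = does (x e ≟ 1ℚ)
  E½ e = does (x e ≟ ½)

  data KeptValue (ℓ : Fin k) : ℚ → Set where
    zero-valued : KeptValue ℓ 0ℚ
    half-valued : ℓ ≡ i* → KeptValue ℓ ½

  keptValue : ∀ e → Kept e → KeptValue (color H e) (x e)
  keptValue e = classify (half-integral e) (color H e ≟ᶠ i*)
    where
    classify : ∀ {v ℓ} → HalfIntegralValue v → (ℓ≟i* : Dec (ℓ ≡ i*)) →
               (does (v ≟ 1ℚ) ∨ (does (v ≟ ½) ∧ not (does ℓ≟i*))) ≡ false → KeptValue ℓ v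
    classify (inj₁ refl)        _            _  = zero-valued
    classify (inj₂ (inj₁ refl)) (yes ℓ≡i*)   _  = half-valued ℓ≡i*
    classify (inj₂ (inj₁ refl)) (no _)       ()
    classify (inj₂ (inj₂ refl)) _            ()

  kept-compatible : FeasibleVC H x → ∀ e f → Kept e → Kept f → ¬ BadPair H e f
  kept-compatible (_ , covered) e f Ke Kf bad@(_ , ℓe≢ℓf) =
    refute (keptValue e Ke) (keptValue f Kf) (covered e f bad)
    where
    refute : ∀ {a b} → KeptValue (color H e) a → KeptValue (color H f) b → 1ℚ ≤ a + b → ⊥
    refute zero-valued     zero-valued     = from-no (1ℚ ≤? 0ℚ + 0ℚ)
    refute zero-valued     (half-valued _) = from-no (1ℚ ≤? 0ℚ + ½)
    refute (half-valued _) zero-valued     = from-no (1ℚ ≤? ½ + 0ℚ)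
    refute (half-valued ℓe≡i*) (half-valued ℓf≡i*) _ = ℓe≢ℓf (trans ℓe≡i* (sym ℓf≡i*))

  module _ (w : Fin m → ℚ) where

    rounded-weight : wt w (roundY H x i*) + wt w (halfOfColor H x i*) ≡ wt w E¹ + wt w E½
    rounded-weight = begin
      wt w (roundY H x i*) + wt w (halfOfColor H x i*)
        ≡⟨ cong₂ _+_ (wt≡sum w (roundY H x i*)) (wt≡sum w (halfOfColor H x i*)) ⟩
      sum (w ↾ roundY H x i*) + sum (w ↾ halfOfColor H x i*)
        ≡⟨ ∑-distrib-+ (w ↾ roundY H x i*) (w ↾ halfOfColor H x i*) ⟨
      ∑[ e < m ] ((w ↾ roundY H x i*) e + (w ↾ halfOfColor H x i*) e)
        ≡⟨ sum-cong-≗ (λ e → rounded-split (half-integral e) (does (color H e ≟ᶠ i*)) (w e)) ⟩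
      ∑[ e < m ] ((w ↾ E¹) e + (w ↾ E½) e)
        ≡⟨ ∑-distrib-+ (w ↾ E¹) (w ↾ E½) ⟩
      sum (w ↾ E¹) + sum (w ↾ E½)
        ≡⟨ cong₂ _+_ (wt≡sum w E¹) (wt≡sum w E½) ⟨
      wt w E¹ + wt w E½
        ∎
      where open ≡-Reasoning

    objVC-halfIntegral : objVC H w x ≡ wt w E¹ + ½ * wt w E½
    objVC-halfIntegral = begin
      objVC H w x
        ≡⟨ objVC≡sum H w x ⟩
      ∑[ e < m ] (w e * x e)
        ≡⟨ sum-cong-≗ (λ e → *-halfIntegral (half-integral e) (w e)) ⟩
      ∑[ e < m ] ((w ↾ E¹) e + ½ * (w ↾ E½) e)
        ≡⟨ ∑-distrib-+ (w ↾ E¹) (λ e → ½ * (w ↾ E½) e) ⟩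
      sum (w ↾ E¹) + ∑[ e < m ] (½ * (w ↾ E½) e)
        ≡⟨ cong (_+_ (sum (w ↾ E¹))) (*-distribˡ-sum ½ (w ↾ E½)) ⟨
      sum (w ↾ E¹) + ½ * sum (w ↾ E½)
        ≡⟨ cong₂ (λ a b → a + ½ * b) (wt≡sum w E¹) (wt≡sum w E½) ⟨
      wt w E¹ + ½ * wt w E½
        ∎
      where open ≡-Reasoning

    wt-E¹≤objVC : (∀ e → 0ℚ ≤ w e) → wt w E¹ ≤ objVC H w x
    wt-E¹≤objVC 0≤w = begin
      wt w E¹                  ≡⟨ +-identityʳ (wt w E¹) ⟨
      wt w E¹ + 0ℚ             ≤⟨ +-monoʳ-≤ (wt w E¹) (*-monoˡ-≤-nonNeg ½ (wt-nonNeg w E½ 0≤w)) ⟩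
      wt w E¹ + ½ * wt w E½    ≡⟨ objVC-halfIntegral ⟨
      objVC H w x              ∎
      where open ≤-Reasoning

    half-weight-by-color : wt w E½ ≡ ∑[ i < k ] wt w (halfOfColor H x i)
    half-weight-by-color = begin
      wt w E½
        ≡⟨ wt≡sum w E½ ⟩
      sum (w ↾ E½)
        ≡⟨ sum-cong-≗ (λ e → color-split (E½ e) (color H e) (w e)) ⟨
      ∑[ e < m ] ∑[ i < k ] (w ↾ halfOfColor H x i) e
        ≡⟨ ∑-comm (λ e i → (w ↾ halfOfColor H x i) e) ⟩
      ∑[ i < k ] sum (w ↾ halfOfColor H x i)
        ≡⟨ sum-cong-≗ (λ i → wt≡sum w (halfOfColor H x i)) ⟨
      ∑[ i < k ] wt w (halfOfColor H x i)
        ∎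
      where
      open ≡-Reasoning
      color-split : ∀ b ℓ q → ∑[ i < k ] [ b ∧ does (ℓ ≟ᶠ i) ] q ≡ [ b ] q
      color-split true  ℓ q = sum-indicator ℓ q
      color-split false ℓ q = sum-replicate-zero k

theorem2 : {n m k : ℕ} → .{{_ : NonZero k}} → (H : ECHypergraph n m k)
    → (w : Fin m → ℚ) → (∀ e → 0ℚ ≤ w e)
    → (x : Fin m → ℚ) → OptimalVC H w x → HalfIntegral H x
    → (i* : Fin k) → (∀ i → wt w (halfOfColor H x i) ≤ wt w (halfOfColor H x i*))
    → ((∀ e f → roundY H x i* e ≡ false → roundY H x i* f ≡ false → ¬ BadPair H e f)
       × (∃[ c ] (∀ e → roundY H x i* e ≡ false → Satisfied H c e))
       × (∀ (c : Fin n → Fin k) → wt w (roundY H x i*) ≤ ((+ 2 / 1) - (+ 2 / k)) * eccCost H w c))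
theorem2 {k = k} H w 0≤w x optimal@(feasible , _) half-integral i* i*-maximal =
    kept-compatible feasible
  , compatible⇒satisfiable H i* (λ e → roundY H x i* e ≟ᵇ false) (kept-compatible feasible)
  , λ c → rounding-bound k (rounded-weight w) (objVC-halfIntegral w) half≤k*max
                         (≤-approxRatio-* k (wt-nonNeg w E¹ 0≤w) monochromatic)
                         (optimalVC≤eccCost H optimal c)
  where
  open Rounding H x half-integral i*
  open ≤-Reasoning

  half≤k*max : wt w E½ ≤ (+ k / 1) * wt w (halfOfColor H x i*)
  half≤k*max = begin
    wt w E½                                ≡⟨ half-weight-by-color w ⟩
    ∑[ i < k ] wt w (halfOfColor H x i)    ≤⟨ sum-mono-≤ i*-maximal ⟩
    ∑[ i < k ] wt w (halfOfColor H x i*)   ≡⟨ sum-const k _ ⟩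
    (+ k / 1) * wt w (halfOfColor H x i*)  ∎

  monochromatic : k ≡ 1 → wt w E¹ ≤ 0ℚ
  monochromatic refl =
    ≤-trans (wt-E¹≤objVC w 0≤w) (optimalVC≤0 H {w} (monochromatic⇒¬BadPair H) optimal)
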